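{- Let $r$ be a positive integer, $(x,y)$ a vertex of the hexagonal grid $G_H$ and $k$ an integer. If $d((x,y),L_k)<r$, then $$\{(x-(r-|y-k|)+j,\,k): j=0,1,\ldots,2(r-|y-k|)\}\subset B_r((x,y)).$$
   Context: The hexagonal grid $G_H$ (brick-wall representation) has vertex set $\mathbb{Z}\times\mathbb{Z}$; every vertex $(x,y)$ is adjacent to $(x-1,y)$ and $(x+1,y)$, and additionally to $(x,y+1)$ if $x+y$ is even, and to $(x,y-1)$ if $x+y$ is odd. $d$ is graph distance in $G_H$; $d(u,V)=\min_{v\in V}d(u,v)$ for a vertex set $V$; $B_r(v)=\{u: d(u,v)\le r\}$; and $L_k=\{(x,k):x\in\mathbb{Z}\}$. -}

module Defs where

open import Data.Nat using (ℕ; zero; suc; _<_; _≤_)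
open import Data.Integer using (ℤ; _+_; _-_; +_; ∣_∣)
open import Data.Product using (_×_; _,_; ∃; ∃-syntax; Σ-syntax)
open import Relation.Binary.PropositionalEquality using (_≡_)

-- Vertices of the hexagonal grid G_H (brick-wall representation).
Vertex : Set
Vertex = ℤ × ℤ

Even : ℤ → Set
Even z = ∃[ m ] (z ≡ m + m)

Odd : ℤ → Set
Odd z = ∃[ m ] (z ≡ m + m + + 1)

data Adj : Vertex → Vertex → Set where
  left  : ∀ x y → Adj (x , y) (x - + 1 , y)
  right : ∀ x y → Adj (x , y) (x + + 1 , y)
  up    : ∀ x y → Even (x + y) → Adj (x , y) (x , y + + 1)
  down  : ∀ x y → Odd (x + y) → Adj (x , y) (x , y - + 1)

data Walk : Vertex → Vertex → ℕ → Set where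
  stay : ∀ u → Walk u u zero
  step : ∀ {u v w n} → Adj u v → Walk v w n → Walk u w (suc n)

-- d(u,v) ≤ n  (graph distance is the minimal length of a walk)
DistLe : Vertex → Vertex → ℕ → Set
DistLe u v n = ∃[ m ] (m ≤ n × Walk u v m)

DistLt : Vertex → Vertex → ℕ → Set
DistLt u v n = ∃[ m ] (m < n × Walk u v m)

InLine : ℤ → Vertex → Set
InLine k (_ , y) = y ≡ k

-- d(u, L_k) < n  (the minimum over L_k is below n iff some vertex of L_k is)
DistLineLt : Vertex → ℤ → ℕ → Set
DistLineLt u k n = ∃[ v ] (InLine k v × DistLt u v n)

InBall : ℕ → Vertex → Vertex → Set
InBall r v u = DistLe u v r

module Submission where

-- Let t = |y - k| be the number of rows between (x,y) and the line L_k and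
-- s = r - t.  The claim is that the segment of L_k of half-width s centred
-- at horizontal position x lies in B_r((x,y)).
--
-- Upward case (k = y + t).  Give a vertex of parity p (of x + y) the level
-- 2y + [x + y even].  Every edge changes the level by at most one, so a walk
-- of length m < r from (x,y) to L_k forces 2t ≤ m + [x + y even], i.e.
-- t ≤ s when x + y is even and t < s when x + y is odd (`climb-bound`).
-- Conversely, from an even vertex one can climb a row in one step, and from
-- an odd vertex one sideways step (left or right, whichever keeps the target
-- in the window) leads to an even vertex; an induction on t then reaches
-- every vertex x - s + j (j ≤ 2s) of row y + t within s + t = r steps
-- (`reach-even`, `reach-odd`).
--
-- Downward case.  The map (a,b) ↦ (a, 1 - b) is a graph automorphism of G_H
-- that exchanges upward and downward edges and keeps horizontal positions,
-- so it reduces the downward case to the upward one (`ball-below`).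

open import Defs
open import Data.Nat using (ℕ; _≤_; _∸_; _*_)
open import Data.Integer using (ℤ; _+_; _-_; +_; ∣_∣)
open import Data.Product using (_,_)

open import Data.Bool using (Bool; true; false; not)
open import Data.Empty using (⊥; ⊥-elim)
open import Data.Nat as ℕ using (zero; suc; z≤n; s≤s; _<_)
import Data.Nat.Properties as ℕₚ
open import Data.Integer as ℤ using (-[1+_]; -_)
import Data.Integer.Properties as ℤₚ
open import Data.Integer.DivMod using (_%ℕ_; _/ℕ_; a≡a%ℕn+[a/ℕn]*n; n%ℕd<d)
open import Data.Integer.Tactic.RingSolver using (solve-∀)
open import Data.Product using (∃-syntax; _×_; proj₂)
open import Data.Sum using (_⊎_; inj₁; inj₂)
open import Relation.Nullary using (yes; no)
open import Relation.Binary.PropositionalEquality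

private
  variable
    u v w : Vertex
    m n : ℕ
    p : Bool

Par : Bool → ℤ → Set
Par true  = Even
Par false = Odd

parity : ∀ z → ∃[ p ] Par p z
parity z = from-remainder (z %ℕ 2) (n%ℕd<d z 2) (a≡a%ℕn+[a/ℕn]*n z 2)
  where
  double : ∀ q → + 0 + q ℤ.* + 2 ≡ q + q
  double = solve-∀
  double+1 : ∀ q → + 1 + q ℤ.* + 2 ≡ q + q + + 1
  double+1 = solve-∀
  from-remainder : ∀ r → r < 2 → z ≡ + r + (z /ℕ 2) ℤ.* + 2 → ∃[ p ] Par p z
  from-remainder 0 _ eq = true , z /ℕ 2 , trans eq (double (z /ℕ 2))
  from-remainder 1 _ eq = false , z /ℕ 2 , trans eq (double+1 (z /ℕ 2))
  from-remainder (suc (suc _)) (s≤s (s≤s ())) _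

one-not-double : ∀ q → q + q ≢ + 1
one-not-double (+ zero) ()
one-not-double (+ suc a) eq with ℕₚ.m+n≡0⇒n≡0 a (ℕₚ.suc-injective (ℤₚ.+-injective eq))
... | ()
one-not-double -[1+ _ ] ()

even-odd-disjoint : ∀ {z} → Even z → Odd z → ⊥
even-odd-disjoint (a , z≡a+a) (b , z≡b+b+1) = one-not-double (a - b) (begin
  (a - b) + (a - b)         ≡⟨ difference a b ⟩
  (a + a) - (b + b)         ≡⟨ cong (_- (b + b)) (trans (sym z≡a+a) z≡b+b+1) ⟩
  (b + b + + 1) - (b + b)   ≡⟨ cancel b ⟩
  + 1                       ∎)
  where
  open ≡-Reasoning
  difference : ∀ a b → (a - b) + (a - b) ≡ (a + a) - (b + b)
  difference = solve-∀
  cancel : ∀ b → (b + b + + 1) - (b + b) ≡ + 1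
  cancel = solve-∀

parity-suc : ∀ z → Par p z → Par (not p) (z + + 1)
parity-suc {true}  z (a , refl) = a , refl
parity-suc {false} z (a , refl) = a + + 1 , shift a
  where
  shift : ∀ a → a + a + + 1 + + 1 ≡ (a + + 1) + (a + + 1)
  shift = solve-∀

parity-pred : ∀ z → Par p z → Par (not p) (z - + 1)
parity-pred {true}  z (a , refl) = a - + 1 , shift a
  where
  shift : ∀ a → a + a - + 1 ≡ (a - + 1) + (a - + 1) + + 1
  shift = solve-∀
parity-pred {false} z (a , refl) = a , shift a
  where
  shift : ∀ a → a + a + + 1 - + 1 ≡ a + a
  shift = solve-∀

parity-add-even : ∀ z e → Par p z → Par p (z + (e + e))
parity-add-even {true}  z e (a , refl) = a + e , shift a e
  where
  shift : ∀ a e → a + a + (e + e) ≡ (a + e) + (a + e)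
  shift = solve-∀
parity-add-even {false} z e (a , refl) = a + e , shift a e
  where
  shift : ∀ a e → a + a + + 1 + (e + e) ≡ (a + e) + (a + e) + + 1
  shift = solve-∀

coordSum : Vertex → ℤ
coordSum (a , b) = a + b

adj-parity : Adj u v → ∀ p → Par p (coordSum u) → Par (not p) (coordSum v)
adj-parity (left x y)   p h = subst (Par (not p)) (sym (moved x y)) (parity-pred {p} _ h)
  where
  moved : ∀ x y → (x - + 1) + y ≡ (x + y) - + 1
  moved = solve-∀
adj-parity (right x y)  p h = subst (Par (not p)) (sym (moved x y)) (parity-suc {p} _ h)
  where
  moved : ∀ x y → (x + + 1) + y ≡ (x + y) + + 1
  moved = solve-∀
adj-parity (up x y _)   p h = subst (Par (not p)) (sym (moved x y)) (parity-suc {p} _ h)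
  where
  moved : ∀ x y → x + (y + + 1) ≡ (x + y) + + 1
  moved = solve-∀
adj-parity (down x y _) p h = subst (Par (not p)) (sym (moved x y)) (parity-pred {p} _ h)
  where
  moved : ∀ x y → x + (y - + 1) ≡ (x + y) - + 1
  moved = solve-∀

mirror-parity : ∀ p x y → Par p (x + y) → Par (not p) (x + (+ 1 - y))
mirror-parity p x y h = subst (Par (not p)) (sym (reflected x y))
  (parity-add-even {not p} _ (- y) (parity-suc {p} _ h))
  where
  reflected : ∀ x y → x + (+ 1 - y) ≡ (x + y) + + 1 + (- y + - y)
  reflected = solve-∀

dist-subst : ∀ {u u' v v' n n'} → u ≡ u' → v ≡ v' → n ≡ n' →
  DistLe u v n → DistLe u' v' n'
dist-subst refl refl refl d = d

dist-prepend : Adj u v → DistLe v w n → DistLe u w (suc n)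
dist-prepend e (m , m≤n , walk) = suc m , s≤s m≤n , step e walk

adj-sym : Adj u v → Adj v u
adj-sym (left x y) =
  subst (λ a → Adj (x - + 1 , y) (a , y)) (back x) (right (x - + 1) y)
  where
  back : ∀ x → x - + 1 + + 1 ≡ x
  back = solve-∀
adj-sym (right x y) =
  subst (λ a → Adj (x + + 1 , y) (a , y)) (back x) (left (x + + 1) y)
  where
  back : ∀ x → x + + 1 - + 1 ≡ x
  back = solve-∀
adj-sym e@(up x y ev) =
  subst (λ b → Adj (x , y + + 1) (x , b)) (back y) (down x (y + + 1) (adj-parity e true ev))
  where
  back : ∀ y → y + + 1 - + 1 ≡ y
  back = solve-∀
adj-sym e@(down x y od) =
  subst (λ b → Adj (x , y - + 1) (x , b)) (back y) (up x (y - + 1) (adj-parity e false od))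
  where
  back : ∀ y → y - + 1 + + 1 ≡ y
  back = solve-∀

walk-snoc : Walk u v m → Adj v w → Walk u w (suc m)
walk-snoc (stay _)      e = step e (stay _)
walk-snoc (step e′ rest) e = step e′ (walk-snoc rest e)

walk-reverse : Walk u v m → Walk v u m
walk-reverse (stay u)      = stay u
walk-reverse (step e rest) = walk-snoc (walk-reverse rest) (adj-sym e)

dist-sym : DistLe u v n → DistLe v u n
dist-sym (m , m≤n , walk) = m , m≤n , walk-reverse walk

walk-left : ∀ n x y → Walk (x , y) (x - + n , y) n
walk-left zero    x y = subst (λ a → Walk (x , y) (a , y) 0) (sym (ℤₚ.+-identityʳ x)) (stay _)
walk-left (suc n) x y =
  step (left x y) (subst (λ a → Walk _ (a , y) n) (further x (+ n)) (walk-left n (x - + 1) y))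
  where
  further : ∀ x n → x - + 1 - n ≡ x - (+ 1 + n)
  further = solve-∀

walk-right : ∀ n x y → Walk (x , y) (x + + n , y) n
walk-right zero    x y = subst (λ a → Walk (x , y) (a , y) 0) (sym (ℤₚ.+-identityʳ x)) (stay _)
walk-right (suc n) x y =
  step (right x y) (subst (λ a → Walk _ (a , y) n) (further x (+ n)) (walk-right n (x + + 1) y))
  where
  further : ∀ x n → x + + 1 + n ≡ x + (+ 1 + n)
  further = solve-∀

mirror : Vertex → Vertex
mirror (a , b) = a , + 1 - b

mirror-adj : Adj u v → Adj (mirror u) (mirror v)
mirror-adj (left x y)    = left x (+ 1 - y)
mirror-adj (right x y)   = right x (+ 1 - y)
mirror-adj (up x y ev)   =
  subst (λ b → Adj (x , + 1 - y) (x , b)) (reflected y) (down x (+ 1 - y) (mirror-parity true x y ev))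
  where
  reflected : ∀ y → + 1 - y - + 1 ≡ + 1 - (y + + 1)
  reflected = solve-∀
mirror-adj (down x y od) =
  subst (λ b → Adj (x , + 1 - y) (x , b)) (reflected y) (up x (+ 1 - y) (mirror-parity false x y od))
  where
  reflected : ∀ y → + 1 - y + + 1 ≡ + 1 - (y - + 1)
  reflected = solve-∀

mirror-walk : Walk u v m → Walk (mirror u) (mirror v) m
mirror-walk (stay u)      = stay (mirror u)
mirror-walk (step e rest) = step (mirror-adj e) (mirror-walk rest)

mirror-dist : DistLe u v n → DistLe (mirror u) (mirror v) n
mirror-dist (m , m≤n , walk) = m , m≤n , mirror-walk walk

mirror-line : ∀ {k r} → DistLineLt u k r → DistLineLt (mirror u) (+ 1 - k) r
mirror-line ((c , _) , refl , m , m<r , walk) = (c , _) , refl , m , m<r , mirror-walk walk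

+-cancelˡ-≤ : ∀ a {b c} → a + b ℤ.≤ a + c → b ℤ.≤ c
+-cancelˡ-≤ a {b} {c} le =
  subst₂ ℤ._≤_ (cancel a b) (cancel a c) (ℤₚ.+-monoʳ-≤ (- a) le)
  where
  cancel : ∀ a b → - a + (a + b) ≡ b
  cancel = solve-∀

bit : Bool → ℕ
bit true  = 1
bit false = 0

level : Bool → Vertex → ℤ
level p (a , b) = b + b + + bit p

level-step : Adj u v → Par p (coordSum u) → level (not p) v ℤ.≤ level p u + + 1
level-step {p = p} (left x y)  _ = sideways p y
  where
  sideways : ∀ p y → y + y + + bit (not p) ℤ.≤ y + y + + bit p + + 1
  sideways true  y = ℤₚ.≤-trans (ℤₚ.i≤i+j (y + y + + 0) (+ 2)) (ℤₚ.≤-reflexive (shift y))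
    where
    shift : ∀ y → y + y + + 0 + + 2 ≡ y + y + + 1 + + 1
    shift = solve-∀
  sideways false y = ℤₚ.≤-reflexive (shift y)
    where
    shift : ∀ y → y + y + + 1 ≡ y + y + + 0 + + 1
    shift = solve-∀
level-step {p = p} (right x y) h = level-step {p = p} (left x y) h
level-step {p = true}  (up x y _)     _  = ℤₚ.≤-reflexive (climbed y)
  where
  climbed : ∀ y → (y + + 1) + (y + + 1) + + 0 ≡ y + y + + 1 + + 1
  climbed = solve-∀
level-step {p = false} (up x y ev)    od = ⊥-elim (even-odd-disjoint ev od)
level-step {p = true}  (down x y od)  ev = ⊥-elim (even-odd-disjoint ev od)
level-step {p = false} (down x y _)   _  =
  ℤₚ.≤-trans (ℤₚ.i≤i+j ((y - + 1) + (y - + 1) + + 1) (+ 2)) (ℤₚ.≤-reflexive (descended y))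
  where
  descended : ∀ y → (y - + 1) + (y - + 1) + + 1 + + 2 ≡ y + y + + 0 + + 1
  descended = solve-∀

climb : Walk u w m → Par p (coordSum u) → proj₂ w + proj₂ w ℤ.≤ level p u + + m
climb {p = p} (stay (a , b)) _ =
  ℤₚ.≤-trans (ℤₚ.i≤i+j (b + b) (+ bit p)) (ℤₚ.i≤i+j _ (+ 0))
climb {p = p} (step {u = u} {n = m} e rest) h = ℤₚ.≤-trans (climb rest (adj-parity e p h))
  (ℤₚ.≤-trans (ℤₚ.+-monoˡ-≤ (+ m) (level-step e h))
              (ℤₚ.≤-reflexive (ℤₚ.+-assoc (level p u) (+ 1) (+ m))))

climb-bound : ∀ {x y c t} → Walk (x , y) (c , y + + t) m → Par p (x + y) →
  t ℕ.+ t ≤ bit p ℕ.+ m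
climb-bound {m} {p} {x} {y} {c} {t} walk h =
  ℤₚ.drop‿+≤+ (+-cancelˡ-≤ (y + y) (begin
    (y + y) + + (t ℕ.+ t)       ≡⟨ rows y (+ t) ⟩
    (y + + t) + (y + + t)       ≤⟨ climb walk h ⟩
    y + y + + bit p + + m       ≡⟨ ℤₚ.+-assoc (y + y) (+ bit p) (+ m) ⟩
    (y + y) + + (bit p ℕ.+ m)   ∎))
  where
  open ℤₚ.≤-Reasoning
  rows : ∀ y t → (y + y) + (t + t) ≡ (y + t) + (y + t)
  rows = solve-∀

row : ∀ s x y j → j ≤ 2 * s → DistLe (x , y) (x - + s + + j , y) s
row s x y j j≤2s with j ℕ.≤? s
... | yes j≤s with ℕₚ.m≤n⇒∃[o]m+o≡n j≤s
...   | a , refl =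
  a , ℕₚ.m≤n+m a j , subst (λ c → Walk _ (c , y) a) (sym (left-of x (+ j) (+ a))) (walk-left a x y)
  where
  left-of : ∀ x j a → x - (j + a) + j ≡ x - a
  left-of = solve-∀
row s x y j j≤2s | no j≰s with ℕₚ.m≤n⇒∃[o]m+o≡n (ℕₚ.<⇒≤ (ℕₚ.≰⇒> j≰s))
...   | b , refl =
  b , b≤s , subst (λ c → Walk _ (c , y) b) (sym (right-of x (+ s) (+ b))) (walk-right b x y)
  where
  right-of : ∀ x s b → x - s + (s + b) ≡ x + b
  right-of = solve-∀
  b≤s : b ≤ s
  b≤s = subst (b ≤_) (ℕₚ.+-identityʳ s) (ℕₚ.+-cancelˡ-≤ s b (s ℕ.+ 0) j≤2s)

-- A window of half-width s + 1 (with s ≥ 1) is covered by the windows of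
-- half-width s around the left and the right neighbour of its centre.
split-window : ∀ s j → 1 ≤ s → j ≤ 2 * suc s →
  j ≤ 2 * s ⊎ ∃[ i ] (j ≡ suc (suc i) × i ≤ 2 * s)
split-window s j 1≤s j≤ with j ℕ.≤? 2 * s
... | yes j≤2s = inj₁ j≤2s
... | no j≰2s with j
...   | zero         = ⊥-elim (j≰2s z≤n)
...   | suc zero     = ⊥-elim (j≰2s (ℕₚ.≤-trans 1≤s (ℕₚ.m≤m+n s (s ℕ.+ 0))))
...   | suc (suc i)  = inj₂ (i , refl , i≤2s)
  where
  i≤2s : i ≤ 2 * s
  i≤2s = ℕₚ.≤-pred (subst (suc i ≤_) (ℕₚ.+-suc s (s ℕ.+ 0)) (ℕₚ.≤-pred j≤))

-- An even
-- vertex climbs one row directly; an odd vertex first steps sideways.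
mutual
  reach-even : ∀ t s x y → t ≤ s → Even (x + y) → ∀ j → j ≤ 2 * s →
    DistLe (x , y) (x - + s + + j , y + + t) (s ℕ.+ t)
  reach-even zero s x y _ _ j j≤ =
    dist-subst refl (cong (_ ,_) (sym (ℤₚ.+-identityʳ y))) (sym (ℕₚ.+-identityʳ s)) (row s x y j j≤)
  reach-even (suc t) s x y t<s ev j j≤ =
    dist-subst refl (cong (_ ,_) (upward y (+ t))) (sym (ℕₚ.+-suc s t))
      (dist-prepend e (reach-odd t s x (y + + 1) t<s (adj-parity e true ev) j j≤))
    where
    e = up x y ev
    upward : ∀ y t → y + + 1 + t ≡ y + (+ 1 + t)
    upward = solve-∀

  reach-odd : ∀ t s x y → suc t ≤ s → Odd (x + y) → ∀ j → j ≤ 2 * s →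
    DistLe (x , y) (x - + s + + j , y + + t) (s ℕ.+ t)
  reach-odd zero s x y _ _ j j≤ =
    dist-subst refl (cong (_ ,_) (sym (ℤₚ.+-identityʳ y))) (sym (ℕₚ.+-identityʳ s)) (row s x y j j≤)
  reach-odd (suc t) (suc s) x y (s≤s t<s) od j j≤
    with split-window s j (ℕₚ.≤-trans (s≤s z≤n) t<s) j≤
  ... | inj₁ j≤2s =
    dist-subst refl (cong (_, _) (via-left x (+ s) (+ j))) refl
      (dist-prepend e (reach-even (suc t) s (x - + 1) y t<s (adj-parity e false od) j j≤2s))
    where
    e = left x y
    via-left : ∀ x s j → x - + 1 - s + j ≡ x - (+ 1 + s) + j
    via-left = solve-∀
  ... | inj₂ (i , refl , i≤2s) =
    dist-subst refl (cong (_, _) (via-right x (+ s) (+ i))) refl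
      (dist-prepend e (reach-even (suc t) s (x + + 1) y t<s (adj-parity e false od) i i≤2s))
    where
    e = right x y
    via-right : ∀ x s i → x + + 1 - s + i ≡ x - (+ 1 + s) + (+ 1 + (+ 1 + i))
    via-right = solve-∀

ball-from-reach : ∀ {r t c T} → t ≤ r → DistLe c T ((r ∸ t) ℕ.+ t) → InBall r c T
ball-from-reach t≤r reach = dist-sym (dist-subst refl refl (ℕₚ.m∸n+n≡m t≤r) reach)

-- The claim when L_k lies t rows above (x,y): the lower bound on the walk to
-- L_k provides exactly the budget required by the upper-bound construction.
ball-above : ∀ r x y t → DistLineLt (x , y) (y + + t) r →
  ∀ j → j ≤ 2 * (r ∸ t) → InBall r (x , y) (x - + (r ∸ t) + + j , y + + t)
ball-above r x y t ((c , _) , refl , m , m<r , walk) j j≤ with parity (x + y)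
... | true , ev =
  ball-from-reach (ℕₚ.≤-trans (ℕₚ.m≤m+n t t) 2t≤r)
    (reach-even t (r ∸ t) x y (ℕₚ.m+n≤o⇒m≤o∸n t 2t≤r) ev j j≤)
  where
  2t≤r : t ℕ.+ t ≤ r
  2t≤r = ℕₚ.≤-trans (climb-bound walk ev) m<r
... | false , od =
  ball-from-reach (ℕₚ.≤-trans (ℕₚ.m≤n+m t (suc t)) 2t<r)
    (reach-odd t (r ∸ t) x y (ℕₚ.m+n≤o⇒m≤o∸n (suc t) 2t<r) od j j≤)
  where
  2t<r : suc t ℕ.+ t ≤ r
  2t<r = ℕₚ.≤-trans (s≤s (climb-bound walk od)) m<r

-- The claim when L_k lies t rows below (x,y), by reflecting the grid.
ball-below : ∀ r x y t → DistLineLt (x , y) (y - + t) r →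
  ∀ j → j ≤ 2 * (r ∸ t) → InBall r (x , y) (x - + (r ∸ t) + + j , y - + t)
ball-below r x y t near j j≤ =
  dist-subst (cong (_ ,_) (reflect-row y (+ t))) (cong (x ,_) (reflect-twice y)) refl
    (mirror-dist (ball-above r x (+ 1 - y) t
      (subst (λ k → DistLineLt (x , + 1 - y) k r) (reflect-line y (+ t)) (mirror-line near)) j j≤))
  where
  reflect-line : ∀ y t → + 1 - (y - t) ≡ (+ 1 - y) + t
  reflect-line = solve-∀
  reflect-row : ∀ y t → + 1 - ((+ 1 - y) + t) ≡ y - t
  reflect-row = solve-∀
  reflect-twice : ∀ y → + 1 - (+ 1 - y) ≡ y
  reflect-twice = solve-∀

data Offset (y k : ℤ) : ℕ → Set where
  above : ∀ {t} → k ≡ y + + t → Offset y k t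
  below : ∀ {t} → k ≡ y - + t → Offset y k t

offset : ∀ y k → Offset y k ∣ y - k ∣
offset y k rewrite ℤₚ.∣i-j∣≡∣j-i∣ y k = by-sign (k - y) (recentre y k)
  where
  recentre : ∀ y k → k ≡ y + (k - y)
  recentre = solve-∀
  by-sign : ∀ d → k ≡ y + d → Offset y k ∣ d ∣
  by-sign (+ t)    k≡y+t   = above k≡y+t
  by-sign -[1+ n ] k≡y-1-n = below k≡y-1-n

-- Split according to the side of row y on which L_k lies.  (The hypothesis
-- 1 ≤ r is implied by the existence of a walk of length < r to L_k.)
claim8 : (r : ℕ) → 1 ≤ r → (x y k : ℤ) →
    DistLineLt (x , y) k r →
    (j : ℕ) → j ≤ 2 * (r ∸ ∣ y - k ∣) →
    InBall r (x , y) ((x - + (r ∸ ∣ y - k ∣)) + + j , k)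
claim8 r _ x y k near j j≤ with ∣ y - k ∣ | offset y k
... | t | above refl = ball-above r x y t near j j≤
... | t | below refl = ball-below r x y t near j j≤
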